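{- Let $G=(V,E)$ be a cubic graph of order $n$. Then $\gamma_{\mathrm{sdR}}^{2}(G)<\frac{5n}{4}$ and $\gamma_{\mathrm{sdR}}(G)<\frac{5n}{4}$.
   Context: All graphs are finite, undirected and simple. For a vertex $u$, $N(u)$ is its open neighborhood and $N[u]=N(u)\cup\{u\}$. For $f:V\to\{ -1,1,2,3\}$ write $V_i=f^{ -1}(i)$ and $f(S)=\sum_{s\in S}f(s)$ for $S\subseteq V$. A function $f:V\to\{ -1,1,2,3\}$ is a signed double Roman domination function (SDRDF) if: (1) every $u\in V_{ -1}$ has a neighbor in $V_3$ or at least two distinct neighbors in $V_2$; (2) every $u\in V_1$ has a neighbor in $V_2\cup V_3$; (3) $f(N[u])\ge 1$ for all $u\in V$. The signed double Roman domination number $\gamma_{\mathrm{sdR}}(G)$ is the minimum of $f(V)$ over all SDRDFs $f$ on $G$. For a positive integer $k$, a signed double Roman $k$-domination function is a function satisfying (1), (2), (3) and additionally $f(N[u])\ge k$ for all $u\in V$; $\gamma_{\mathrm{sdR}}^{k}(G)$ denotes the minimum of $f(V)$ over all such functions. A cubic graph is a 3-regular graph. -}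

module Defs where

open import Data.Nat using (ℕ)
open import Data.Fin using (Fin)
open import Data.Bool using (Bool; true; false; if_then_else_; _∨_)
open import Data.Integer using (ℤ; +_; -[1+_]) renaming (_+_ to _+ℤ_; _≤_ to _≤ℤ_)
open import Data.List using (List; length; filter; map; foldr; allFin)
open import Data.Product using (Σ; ∃; _×_; _,_)
open import Data.Sum using (_⊎_)
open import Relation.Binary.PropositionalEquality using (_≡_; _≢_)
open import Data.Fin using (_≟_)
open import Relation.Nullary.Decidable using (⌊_⌋)

record Graph (n : ℕ) : Set where
  field
    adj     : Fin n → Fin n → Bool
    symm    : ∀ u v → adj u v ≡ adj v u
    irrefl  : ∀ u → adj u u ≡ false
open Graph public

_∼[_]_ : ∀ {n} → Fin n → Graph n → Fin n → Set
u ∼[ G ] v = adj G u v ≡ true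

degree : ∀ {n} → Graph n → Fin n → ℕ
degree {n} G u = length (filter (λ v → adj G u v Data.Bool.≟ true) (allFin n))

Cubic : ∀ {n} → Graph n → Set
Cubic {n} G = ∀ u → degree G u ≡ 3

data Label : Set where
  m1 one two three : Label

val : Label → ℤ
val m1    = -[1+ 0 ]
val one   = + 1
val two   = + 2
val three = + 3

sumℤ : List ℤ → ℤ
sumℤ = foldr _+ℤ_ (+ 0)

weight : ∀ {n} → (Fin n → Label) → ℤ
weight {n} f = sumℤ (map (λ v → val (f v)) (allFin n))

inClosed : ∀ {n} → Graph n → Fin n → Fin n → Bool
inClosed G u v = adj G u v ∨ ⌊ u ≟ v ⌋

closedSum : ∀ {n} → Graph n → (Fin n → Label) → Fin n → ℤ
closedSum {n} G f u =
  sumℤ (map (λ v → if inClosed G u v then val (f v) else + 0) (allFin n))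

record IsSDRkDF {n : ℕ} (G : Graph n) (k : ℕ) (f : Fin n → Label) : Set where
  field
    cond1 : ∀ u → f u ≡ m1 →
              (∃ λ v → u ∼[ G ] v × f v ≡ three)
              ⊎ (∃ λ v → ∃ λ w → v ≢ w × u ∼[ G ] v × u ∼[ G ] w
                                 × f v ≡ two × f w ≡ two)
    cond2 : ∀ u → f u ≡ one →
              ∃ λ v → u ∼[ G ] v × (f v ≡ two ⊎ f v ≡ three)
    cond3 : ∀ u → + k ≤ℤ closedSum G f u

IsSDRDF : ∀ {n} → Graph n → (Fin n → Label) → Set
IsSDRDF G f = IsSDRkDF G 1 f

IsSDRkDomNumber : ∀ {n} → Graph n → ℕ → ℤ → Set
IsSDRkDomNumber {n} G k γ =
  (Σ (Fin n → Label) λ f → IsSDRkDF G k f × weight f ≡ γ)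
  × (∀ f → IsSDRkDF G k f → γ ≤ℤ weight f)

IsSDRDomNumber : ∀ {n} → Graph n → ℤ → Set
IsSDRDomNumber G γ = IsSDRkDomNumber G 1 γ

{-# OPTIONS --safe #-}
module Submission where

-- Label a vertex set I with −1 and every other vertex with 2.  If each closed neighbourhood
-- contains at most two vertices of I, then in a cubic graph each closed neighbourhood has
-- weight 2(4 − c) − c ≥ 2, where c ≤ 2 counts its vertices in I, and each vertex of I has two
-- neighbours labelled 2; so the labelling is a signed double Roman 2-domination function, and
-- hence also an SDRDF, of weight 2|O| − |I| where O is the complement of I.
-- Grow such an I greedily from an edge ab until no vertex can be added without violating the
-- condition.  Then every vertex of O has a neighbour in I or a neighbour with at least two
-- neighbours in I; such a heavy vertex has at most one neighbour in O, so double counting gives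
-- |O| ≤ e(I, O), and e(I, O) < 3|I| since the edge ab lies inside I.  Finally |O| < 3|I| and
-- n = |I| + |O| give 4(2|O| − |I|) < 5n.

open import Defs
open import Data.Nat using (ℕ)

module FiniteCounts where

  open import Data.Bool using (Bool; true; false; not; _∧_; _∨_; if_then_else_)
  import Data.Bool as Bool
  open import Data.Fin using (Fin; zero; suc; _≟_; punchIn)
  import Data.Fin.Properties as Fin
  open import Data.Nat using (zero; suc; _+_; _≤_; _<_; z≤n)
  open import Data.Nat.Properties
    using (+-*-semiring; +-mono-≤; +-mono-<-≤; +-mono-≤-<; m≤m+n; m≤n+m; ≤-refl; ≤-trans; ≤-pred;
           +-suc; +-identityʳ)
  open import Data.List using (length; filter; tabulate)
  open import Data.Product using (∃; ∃₂; _×_; _,_)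
  open import Function using (_∘_)
  open import Relation.Binary.PropositionalEquality
    using (_≡_; _≢_; refl; cong; cong₂; trans; sym; ≡-≟-identity; ≢-≟-identity;
           module ≡-Reasoning)
  open import Relation.Nullary.Decidable using (⌊_⌋)
  open import Algebra.Properties.Semiring.Sum +-*-semiring
    using (sum; sum-remove; sum-cong-≗; sum-replicate-zero; ∑-distrib-+)

  toℕ : Bool → ℕ
  toℕ true  = 1
  toℕ false = 0

  toℕ≤1 : ∀ b → toℕ b ≤ 1
  toℕ≤1 true  = ≤-refl
  toℕ≤1 false = z≤n

  toℕ-∨-∧ : ∀ a b c → toℕ ((a ∨ b) ∧ c) ≤ toℕ (a ∧ c) + toℕ (b ∧ c)
  toℕ-∨-∧ true  b c = m≤m+n _ _
  toℕ-∨-∧ false b c = ≤-refl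

  toℕ-∧-+-not-∧ : ∀ x a → toℕ (x ∧ a) + toℕ (not x ∧ a) ≡ toℕ a
  toℕ-∧-+-not-∧ true  a = +-identityʳ _
  toℕ-∧-+-not-∧ false a = refl

  count : ∀ {n} → (Fin n → Bool) → ℕ
  count p = sum (toℕ ∘ p)

  sum-mono-≤ : ∀ {n} {f g : Fin n → ℕ} → (∀ i → f i ≤ g i) → sum f ≤ sum g
  sum-mono-≤ {zero}  f≤g = z≤n
  sum-mono-≤ {suc n} f≤g = +-mono-≤ (f≤g zero) (sum-mono-≤ (f≤g ∘ suc))

  sum-mono-< : ∀ {n} {f g : Fin n → ℕ} → (∀ i → f i ≤ g i) → ∀ j → f j < g j →
               sum f < sum g
  sum-mono-< f≤g zero    fj<gj = +-mono-<-≤ fj<gj (sum-mono-≤ (f≤g ∘ suc))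
  sum-mono-< f≤g (suc j) fj<gj = +-mono-≤-< (f≤g zero) (sum-mono-< (f≤g ∘ suc) j fj<gj)

  ≤-sum : ∀ {n} (f : Fin n → ℕ) i → f i ≤ sum f
  ≤-sum f zero    = m≤m+n _ _
  ≤-sum f (suc i) = ≤-trans (≤-sum (f ∘ suc) i) (m≤n+m _ (f zero))

  1≤count : ∀ {n} (p : Fin n → Bool) {i} → p i ≡ true → 1 ≤ count p
  1≤count p {i} pi = ≤-trans (1≤toℕ pi) (≤-sum (toℕ ∘ p) i)
    where
    1≤toℕ : ∀ {b} → b ≡ true → 1 ≤ toℕ b
    1≤toℕ refl = ≤-refl

  length-filter-tabulate : ∀ {A : Set} {m} (q : A → Bool) (f : Fin m → A) →
                           length (filter (λ x → q x Bool.≟ true) (tabulate f)) ≡ count (q ∘ f)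
  length-filter-tabulate {m = zero}  q f = refl
  length-filter-tabulate {m = suc m} q f with q (f zero)
  ... | true  = cong suc (length-filter-tabulate q (f ∘ suc))
  ... | false = length-filter-tabulate q (f ∘ suc)

  count-∧ˡ : ∀ {n} b (p : Fin n → Bool) → count (λ i → b ∧ p i) ≡ (if b then count p else 0)
  count-∧ˡ         true  p = refl
  count-∧ˡ {n = n} false p = sum-replicate-zero n

  count-+-count-not : ∀ {n} (p : Fin n → Bool) → count p + count (not ∘ p) ≡ n
  count-+-count-not {zero}  p = refl
  count-+-count-not {suc n} p with p zero
  ... | true  = cong suc (count-+-count-not (p ∘ suc))
  ... | false = trans (+-suc _ _) (cong suc (count-+-count-not (p ∘ suc)))

  count-∧-+-count-not-∧ : ∀ {n} (p a : Fin n → Bool) →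
                          count (λ i → p i ∧ a i) + count (λ i → not (p i) ∧ a i) ≡ count a
  count-∧-+-count-not-∧ p a =
    trans (sym (∑-distrib-+ (λ i → toℕ (p i ∧ a i)) (λ i → toℕ (not (p i) ∧ a i))))
          (sum-cong-≗ (λ i → toℕ-∧-+-not-∧ (p i) (a i)))

  ⌊≟⌋-refl : ∀ {n} (u : Fin n) → ⌊ u ≟ u ⌋ ≡ true
  ⌊≟⌋-refl u = cong ⌊_⌋ (≡-≟-identity _≟_ refl)

  ⌊≟⌋-≢ : ∀ {n} {u v : Fin n} → u ≢ v → ⌊ u ≟ v ⌋ ≡ false
  ⌊≟⌋-≢ u≢v = cong ⌊_⌋ (≢-≟-identity _≟_ u≢v)

  count-≟ : ∀ {n} (u : Fin n) (p : Fin n → Bool) →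
            count (λ v → ⌊ u ≟ v ⌋ ∧ p v) ≡ toℕ (p u)
  count-≟ {suc n} u p = begin
    count (λ v → ⌊ u ≟ v ⌋ ∧ p v)
      ≡⟨ sum-remove {i = u} (λ v → toℕ (⌊ u ≟ v ⌋ ∧ p v)) ⟩
    toℕ (⌊ u ≟ u ⌋ ∧ p u) + sum {n} (λ j → toℕ (⌊ u ≟ punchIn u j ⌋ ∧ p (punchIn u j)))
      ≡⟨ cong₂ (λ b m → toℕ (b ∧ p u) + m) (⌊≟⌋-refl u) (sum-cong-≗ {n} elsewhere) ⟩
    toℕ (p u) + sum {n} (λ _ → 0)
      ≡⟨ cong (toℕ (p u) +_) (sum-replicate-zero n) ⟩
    toℕ (p u) + 0
      ≡⟨ +-identityʳ _ ⟩
    toℕ (p u) ∎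
    where
    open ≡-Reasoning
    elsewhere : ∀ j → toℕ (⌊ u ≟ punchIn u j ⌋ ∧ p (punchIn u j)) ≡ 0
    elsewhere j =
      cong (λ b → toℕ (b ∧ p (punchIn u j))) (⌊≟⌋-≢ (Fin.punchInᵢ≢i u j ∘ sym))

  0<count⇒∃ : ∀ {n} (p : Fin n → Bool) → 0 < count p → ∃ λ i → p i ≡ true
  0<count⇒∃ {suc n} p h with p zero in eq
  ... | true  = zero , eq
  ... | false = let i , pi = 0<count⇒∃ (p ∘ suc) h in suc i , pi

  1<count⇒∃₂ : ∀ {n} (p : Fin n → Bool) → 1 < count p →
               ∃₂ λ v w → v ≢ w × p v ≡ true × p w ≡ true
  1<count⇒∃₂ {suc n} p h with p zero in eq
  ... | true  = let w , pw = 0<count⇒∃ (p ∘ suc) (≤-pred h) in zero , suc w , (λ ()) , eq , pw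
  ... | false = let v , w , v≢w , pv , pw = 1<count⇒∃₂ (p ∘ suc) h in
                suc v , suc w , v≢w ∘ Fin.suc-injective , pv , pw

module IntegerArithmetic where

  open import Data.Fin using (Fin; zero; suc)
  open import Data.Integer using (ℤ; +_; -_; _+_; _-_; _*_; _≤_; _<_; +≤+; +<+)
  open import Data.Integer.Properties using (pos-+; pos-*; +-monoˡ-≤; +-monoˡ-<; module ≤-Reasoning)
  open import Data.Integer.Tactic.RingSolver using (solve-∀)
  open import Data.List using (tabulate; map; allFin)
  open import Data.List.Properties using (map-tabulate; tabulate-cong)
  import Data.Nat as ℕ
  import Data.Nat.Properties as ℕ
  open import Data.Nat.Tactic.RingSolver as ℕ-Solver using ()
  open import Function using (_∘_)
  open import Relation.Binary.PropositionalEquality using (_≡_; refl; cong; cong₂; trans; sym)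
  open import Algebra.Properties.Semiring.Sum ℕ.+-*-semiring using (sum)

  +-difference : ∀ a b c d → (+ a - + b) + (+ c - + d) ≡ + (a ℕ.+ c) - + (b ℕ.+ d)
  +-difference a b c d =
    trans (regroup (+ a) (+ b) (+ c) (+ d)) (sym (cong₂ _-_ (pos-+ a c) (pos-+ b d)))
    where
    regroup : ∀ w x y z → (w - x) + (y - z) ≡ (w + y) - (x + z)
    regroup = solve-∀

  sumℤ-tabulate-difference : ∀ {m} (a b : Fin m → ℕ.ℕ) →
                             sumℤ (tabulate (λ i → + a i - + b i)) ≡ + sum a - + sum b
  sumℤ-tabulate-difference {ℕ.zero}  a b = refl
  sumℤ-tabulate-difference {ℕ.suc m} a b =
    trans (cong (_+_ (+ a zero - + b zero)) (sumℤ-tabulate-difference (a ∘ suc) (b ∘ suc)))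
          (+-difference (a zero) (b zero) _ _)

  sumℤ-allFin-difference : ∀ {m} (h : Fin m → ℤ) (a b : Fin m → ℕ.ℕ) →
                           (∀ i → h i ≡ + a i - + b i) →
                           sumℤ (map h (allFin m)) ≡ + sum a - + sum b
  sumℤ-allFin-difference h a b h≡a-b =
    trans (cong sumℤ (trans (map-tabulate (λ i → i) h) (tabulate-cong h≡a-b)))
          (sumℤ-tabulate-difference a b)

  private
    +-∸-cancel : ∀ x y → x + y - y ≡ x
    +-∸-cancel = solve-∀

  ≤-difference : ∀ {k a b} → k ℕ.+ b ℕ.≤ a → + k ≤ + a - + b
  ≤-difference {k} {a} {b} k+b≤a = begin
    + k                 ≡⟨ sym (+-∸-cancel (+ k) (+ b)) ⟩
    + k + + b - + b     ≡⟨ cong (_- + b) (sym (pos-+ k b)) ⟩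
    + (k ℕ.+ b) - + b   ≤⟨ +-monoˡ-≤ (- + b) (+≤+ k+b≤a) ⟩
    + a - + b           ∎
    where open ≤-Reasoning

  difference-< : ∀ {a b c} → a ℕ.< c ℕ.+ b → + a - + b < + c
  difference-< {a} {b} {c} a<c+b = begin-strict
    + a - + b           <⟨ +-monoˡ-< (- + b) (+<+ a<c+b) ⟩
    + (c ℕ.+ b) - + b   ≡⟨ cong (_- + b) (pos-+ c b) ⟩
    + c + + b - + b     ≡⟨ +-∸-cancel (+ c) (+ b) ⟩
    + c                 ∎
    where open ≤-Reasoning

  4*[2o]<5*[i+o]+4i : ∀ i o → o ℕ.< 3 ℕ.* i →
                      4 ℕ.* (2 ℕ.* o) ℕ.< 5 ℕ.* (i ℕ.+ o) ℕ.+ 4 ℕ.* i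
  4*[2o]<5*[i+o]+4i i o o<3i = begin-strict
    4 ℕ.* (2 ℕ.* o)               <⟨ ℕ.m<m+n _ (ℕ.s≤s ℕ.z≤n) ⟩
    4 ℕ.* (2 ℕ.* o) ℕ.+ 3         ≡⟨ lhs o ⟩
    5 ℕ.* o ℕ.+ 3 ℕ.* (1 ℕ.+ o)   ≤⟨ ℕ.+-monoʳ-≤ (5 ℕ.* o) (ℕ.*-monoʳ-≤ 3 o<3i) ⟩
    5 ℕ.* o ℕ.+ 3 ℕ.* (3 ℕ.* i)   ≡⟨ rhs i o ⟩
    5 ℕ.* (i ℕ.+ o) ℕ.+ 4 ℕ.* i   ∎
    where
    open ℕ.≤-Reasoning
    lhs : ∀ o → 4 ℕ.* (2 ℕ.* o) ℕ.+ 3 ≡ 5 ℕ.* o ℕ.+ 3 ℕ.* (1 ℕ.+ o)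
    lhs = ℕ-Solver.solve-∀
    rhs : ∀ i o → 5 ℕ.* o ℕ.+ 3 ℕ.* (3 ℕ.* i) ≡ 5 ℕ.* (i ℕ.+ o) ℕ.+ 4 ℕ.* i
    rhs = ℕ-Solver.solve-∀

  4*[2o-i]<5*[i+o] : ∀ i o → o ℕ.< 3 ℕ.* i →
                     + 4 * (+ (2 ℕ.* o) - + i) < + (5 ℕ.* (i ℕ.+ o))
  4*[2o-i]<5*[i+o] i o o<3i = begin-strict
    + 4 * (+ (2 ℕ.* o) - + i)               ≡⟨ distribute (+ (2 ℕ.* o)) (+ i) ⟩
    + 4 * + (2 ℕ.* o) - + 4 * + i           ≡⟨ cong₂ _-_ (sym (pos-* 4 (2 ℕ.* o))) (sym (pos-* 4 i)) ⟩
    + (4 ℕ.* (2 ℕ.* o)) - + (4 ℕ.* i)       <⟨ difference-< (4*[2o]<5*[i+o]+4i i o o<3i) ⟩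
    + (5 ℕ.* (i ℕ.+ o))                     ∎
    where
    open ≤-Reasoning
    distribute : ∀ x y → + 4 * (x - y) ≡ + 4 * x - + 4 * y
    distribute = solve-∀

module Neighbourhoods {n : ℕ} (G : Graph n) where

  open FiniteCounts
  open import Data.Bool using (Bool; true; false; not; _∧_; _∨_)
  import Data.Bool as Bool
  open import Data.Bool.Properties using (∨-identityʳ; ∨-zeroʳ; ∧-zeroʳ)
  open import Data.Empty using (⊥-elim)
  open import Data.Fin using (Fin; _≟_)
  open import Data.Fin.Properties using (any?; all?; ¬∀⟶∃¬)
  open import Data.Nat using (_+_; _≤_; _<_; _≤?_; z≤n; s≤s)
  open import Data.Nat.Induction using (<-wellFounded)
  open import Data.Nat.Properties
    using (+-*-semiring; ≤-refl; ≤-reflexive; ≤-trans; ≰⇒>; +-cancelʳ-≤; +-identityʳ;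
           module ≤-Reasoning)
  open import Data.Product using (∃; _×_; _,_)
  open import Function using (_∘_)
  open import Induction.WellFounded using (Acc; acc)
  open import Relation.Binary.PropositionalEquality
    using (_≡_; _≢_; refl; cong; trans; sym; module ≡-Reasoning)
  open import Relation.Nullary using (Dec; yes; no; ¬_)
  open import Relation.Nullary.Decidable using (⌊_⌋; _×-dec_; _→-dec_)
  open import Algebra.Properties.Semiring.Sum +-*-semiring
    using (sum; sum-cong-≗; sum-replicate-zero; ∑-distrib-+)

  degreeIn : (Fin n → Bool) → Fin n → ℕ
  degreeIn X v = count (λ w → X w ∧ adj G v w)

  closedDegreeIn : (Fin n → Bool) → Fin n → ℕ
  closedDegreeIn X v = count (λ w → X w ∧ inClosed G v w)

  degree≡count : ∀ v → degree G v ≡ count (adj G v)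
  degree≡count v = length-filter-tabulate (adj G v) (λ w → w)

  closedDegreeIn≡ : ∀ X v → closedDegreeIn X v ≡ degreeIn X v + toℕ (X v)
  closedDegreeIn≡ X v = begin
    closedDegreeIn X v
      ≡⟨ sum-cong-≗ split ⟩
    sum (λ w → toℕ (X w ∧ adj G v w) + toℕ (⌊ v ≟ w ⌋ ∧ X w))
      ≡⟨ ∑-distrib-+ (λ w → toℕ (X w ∧ adj G v w)) (λ w → toℕ (⌊ v ≟ w ⌋ ∧ X w)) ⟩
    degreeIn X v + count (λ w → ⌊ v ≟ w ⌋ ∧ X w)
      ≡⟨ cong (degreeIn X v +_) (count-≟ v X) ⟩
    degreeIn X v + toℕ (X v) ∎
    where
    open ≡-Reasoning
    disjoint : ∀ x a e → a ∧ e ≡ false → toℕ (x ∧ (a ∨ e)) ≡ toℕ (x ∧ a) + toℕ (e ∧ x)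
    disjoint true  true  true  ()
    disjoint true  true  false _ = refl
    disjoint true  false true  _ = refl
    disjoint true  false false _ = refl
    disjoint false a     true  _ = refl
    disjoint false a     false _ = refl
    loopless : ∀ w → adj G v w ∧ ⌊ v ≟ w ⌋ ≡ false
    loopless w with v ≟ w
    ... | yes refl = cong (_∧ true) (irrefl G v)
    ... | no _     = ∧-zeroʳ (adj G v w)
    split : ∀ w → toℕ (X w ∧ inClosed G v w) ≡
                  toℕ (X w ∧ adj G v w) + toℕ (⌊ v ≟ w ⌋ ∧ X w)
    split w = disjoint (X w) (adj G v w) ⌊ v ≟ w ⌋ (loopless w)

  _⊆_ : (Fin n → Bool) → (Fin n → Bool) → Set
  X ⊆ Y = ∀ {v} → X v ≡ true → Y v ≡ true

  ∅ : Fin n → Bool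
  ∅ _ = false

  insert : Fin n → (Fin n → Bool) → Fin n → Bool
  insert v X w = ⌊ v ≟ w ⌋ ∨ X w

  insert-self : ∀ v X → insert v X v ≡ true
  insert-self v X = cong (_∨ X v) (⌊≟⌋-refl v)

  ⊆-insert : ∀ v X → X ⊆ insert v X
  ⊆-insert v X {w} Xw = trans (cong (⌊ v ≟ w ⌋ ∨_) Xw) (∨-zeroʳ _)

  closedDegreeIn-∅ : ∀ v → closedDegreeIn ∅ v ≡ 0
  closedDegreeIn-∅ v = sum-replicate-zero n

  closedDegreeIn-insert : ∀ v X z →
                          closedDegreeIn (insert v X) z ≤ toℕ (inClosed G z v) + closedDegreeIn X z
  closedDegreeIn-insert v X z = begin
    closedDegreeIn (insert v X) z
      ≤⟨ sum-mono-≤ (λ w → toℕ-∨-∧ ⌊ v ≟ w ⌋ (X w) (inClosed G z w)) ⟩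
    sum (λ w → toℕ (⌊ v ≟ w ⌋ ∧ inClosed G z w) + toℕ (X w ∧ inClosed G z w))
      ≡⟨ ∑-distrib-+ (λ w → toℕ (⌊ v ≟ w ⌋ ∧ inClosed G z w))
                     (λ w → toℕ (X w ∧ inClosed G z w)) ⟩
    count (λ w → ⌊ v ≟ w ⌋ ∧ inClosed G z w) + closedDegreeIn X z
      ≡⟨ cong (_+ closedDegreeIn X z) (count-≟ v (inClosed G z)) ⟩
    toℕ (inClosed G z v) + closedDegreeIn X z ∎
    where open ≤-Reasoning

  Sparse : (Fin n → Bool) → Set
  Sparse I = ∀ v → closedDegreeIn I v ≤ 2

  sparse-∅ : Sparse ∅
  sparse-∅ v = ≤-trans (≤-reflexive (closedDegreeIn-∅ v)) z≤n

  sparse-insert : ∀ {I} v → Sparse I → (∀ w → inClosed G w v ≡ true → closedDegreeIn I w ≤ 1) →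
                  Sparse (insert v I)
  sparse-insert {I} v sparse room z =
    ≤-trans (closedDegreeIn-insert v I z) (bound (inClosed G z v) refl)
    where
    bound : ∀ b → inClosed G z v ≡ b → toℕ b + closedDegreeIn I z ≤ 2
    bound true  zv = s≤s (room z zv)
    bound false _  = sparse z

  sparse-pair : ∀ a b → Sparse (insert a (insert b ∅))
  sparse-pair a b = sparse-insert a (sparse-insert b sparse-∅ empty) room
    where
    empty : ∀ w → inClosed G w b ≡ true → closedDegreeIn ∅ w ≤ 1
    empty w _ = ≤-trans (≤-reflexive (closedDegreeIn-∅ w)) z≤n
    room : ∀ w → inClosed G w a ≡ true → closedDegreeIn (insert b ∅) w ≤ 1
    room w _ = begin
      closedDegreeIn (insert b ∅) w              ≤⟨ closedDegreeIn-insert b ∅ w ⟩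
      toℕ (inClosed G w b) + closedDegreeIn ∅ w  ≡⟨ cong (toℕ (inClosed G w b) +_) (closedDegreeIn-∅ w) ⟩
      toℕ (inClosed G w b) + 0                   ≡⟨ +-identityʳ _ ⟩
      toℕ (inClosed G w b)                       ≤⟨ toℕ≤1 _ ⟩
      1                                          ∎
      where open ≤-Reasoning

  degreeIn≤1 : ∀ {I v} → Sparse I → I v ≡ true → degreeIn I v ≤ 1
  degreeIn≤1 {I} {v} sparse Iv = +-cancelʳ-≤ 1 (degreeIn I v) 1 (begin
    degreeIn I v + 1           ≡⟨ cong ((degreeIn I v +_) ∘ toℕ) (sym Iv) ⟩
    degreeIn I v + toℕ (I v)   ≡⟨ closedDegreeIn≡ I v ⟨
    closedDegreeIn I v         ≤⟨ sparse v ⟩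
    2                          ∎)
    where open ≤-Reasoning

  Insertable : (Fin n → Bool) → Fin n → Set
  Insertable I v = I v ≡ false × (∀ w → inClosed G w v ≡ true → closedDegreeIn I w ≤ 1)

  room? : ∀ I v w → Dec (inClosed G w v ≡ true → closedDegreeIn I w ≤ 1)
  room? I v w = (inClosed G w v Bool.≟ true) →-dec (closedDegreeIn I w ≤? 1)

  insertable? : ∀ I v → Dec (Insertable I v)
  insertable? I v = (I v Bool.≟ false) ×-dec all? (room? I v)

  Maximal : (Fin n → Bool) → Set
  Maximal I = ∀ v → I v ≡ false → ∃ λ w → inClosed G w v ≡ true × 1 < closedDegreeIn I w

  maximal-if-stuck : ∀ {I} → (∀ v → ¬ Insertable I v) → Maximal I
  maximal-if-stuck {I} stuck v Iv with ¬∀⟶∃¬ n _ (room? I v) (λ room → stuck v (Iv , room))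
  ... | w , blocked with inClosed G w v in wv
  ...   | true  = w , wv , ≰⇒> (λ le → blocked (λ _ → le))
  ...   | false = ⊥-elim (blocked (λ ()))

  count-not-insert< : ∀ {I v} → I v ≡ false → count (not ∘ insert v I) < count (not ∘ I)
  count-not-insert< {I} {v} Iv = sum-mono-< pointwise v (here (I v) Iv)
    where
    pointwise : ∀ w → toℕ (not (⌊ v ≟ w ⌋ ∨ I w)) ≤ toℕ (not (I w))
    pointwise w with ⌊ v ≟ w ⌋
    ... | true  = z≤n
    ... | false = ≤-refl
    here : ∀ b → b ≡ false → toℕ (not (⌊ v ≟ v ⌋ ∨ b)) < toℕ (not b)
    here false _ rewrite ⌊≟⌋-refl v = s≤s z≤n

  grow : ∀ I → Sparse I → Acc _<_ (count (not ∘ I)) →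
         ∃ λ J → I ⊆ J × Sparse J × Maximal J
  grow I sparse (acc smaller) with any? (insertable? I)
  ... | no stuck = I , (λ Iv → Iv) , sparse , maximal-if-stuck (λ v ins → stuck (v , ins))
  ... | yes (v , Iv , room) =
    let J , insert⊆J , sparseJ , maximalJ = grow (insert v I) (sparse-insert v sparse room)
                                                 (smaller (count-not-insert< Iv))
    in J , (λ Iw → insert⊆J (⊆-insert v I Iw)) , sparseJ , maximalJ

  maximal-sparse-superset : ∀ I → Sparse I → ∃ λ J → I ⊆ J × Sparse J × Maximal J
  maximal-sparse-superset I sparse = grow I sparse (<-wellFounded _)

  adj-if-inClosed : ∀ {w v} → inClosed G w v ≡ true → w ≢ v → adj G w v ≡ true
  adj-if-inClosed {w} {v} wv w≢v = trans (sym (∨-identityʳ (adj G w v)))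
                                         (trans (cong (adj G w v ∨_) (sym (⌊≟⌋-≢ w≢v))) wv)

module CubicGraphs {n : ℕ} {G : Graph n} (cubic : Cubic G) where

  open FiniteCounts
  open Neighbourhoods G
  open import Data.Bool using (Bool; true; false; not; _∧_; if_then_else_)
  open import Data.Bool.Properties using (∧-assoc; ∧-comm)
  open import Data.Empty using (⊥-elim)
  open import Data.Fin using (Fin)
  open import Data.Nat using (zero; suc; _+_; _*_; _≤_; _<_; _≤ᵇ_; z≤n; s≤s)
  open import Data.Nat.Properties
    using (+-*-semiring; ≤-reflexive; ≤-trans; +-cancelˡ-≤; +-cancelʳ-≤; +-comm;
           +-monoʳ-≤; +-monoˡ-≤; +-identityʳ; m<m+n; n≮0; module ≤-Reasoning)
  open import Data.Product using (∃; _,_)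
  open import Function using (_∘_)
  open import Relation.Binary.PropositionalEquality
    using (_≡_; _≢_; refl; cong; cong₂; trans; sym; subst; module ≡-Reasoning)
  open import Algebra.Properties.Semiring.Sum +-*-semiring
    using (sum; sum-cong-≗; ∑-distrib-+; ∑-comm; *-distribˡ-sum)

  count-adj : ∀ v → count (adj G v) ≡ 3
  count-adj v = trans (sym (degree≡count v)) (cubic v)

  neighbour : ∀ v → ∃ λ w → adj G v w ≡ true
  neighbour v = 0<count⇒∃ (adj G v) (≤-trans (s≤s z≤n) (≤-reflexive (sym (count-adj v))))

  degreeIn-+-degreeIn-not : ∀ X v → degreeIn X v + degreeIn (not ∘ X) v ≡ 3
  degreeIn-+-degreeIn-not X v = trans (count-∧-+-count-not-∧ X (adj G v)) (count-adj v)

  closedDegreeIn-+-closedDegreeIn-not : ∀ X v →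
                                        closedDegreeIn X v + closedDegreeIn (not ∘ X) v ≡ 4
  closedDegreeIn-+-closedDegreeIn-not X v = begin
    closedDegreeIn X v + closedDegreeIn (not ∘ X) v
      ≡⟨ count-∧-+-count-not-∧ X (inClosed G v) ⟩
    count (inClosed G v)
      ≡⟨ closedDegreeIn≡ (λ _ → true) v ⟩
    count (adj G v) + 1
      ≡⟨ cong (_+ 1) (count-adj v) ⟩
    4 ∎
    where open ≡-Reasoning

  edges : (Fin n → Bool) → (Fin n → Bool) → ℕ
  edges X Y = sum λ v → count λ w → X v ∧ (Y w ∧ adj G v w)

  edges≡ : ∀ X Y → edges X Y ≡ sum (λ v → if X v then degreeIn Y v else 0)
  edges≡ X Y = sum-cong-≗ (λ v → count-∧ˡ (X v) (λ w → Y w ∧ adj G v w))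

  edges-comm : ∀ X Y → edges X Y ≡ edges Y X
  edges-comm X Y =
    trans (∑-comm (λ v w → toℕ (X v ∧ (Y w ∧ adj G v w))))
          (sum-cong-≗ λ w → sum-cong-≗ λ v → cong toℕ (swap (X v) (Y w) (symm G v w)))
    where
    swap : ∀ x y {a b} → a ≡ b → x ∧ (y ∧ a) ≡ y ∧ (x ∧ b)
    swap x y refl =
      trans (sym (∧-assoc x y _)) (trans (cong (_∧ _) (∧-comm x y)) (∧-assoc y x _))

  edges-+-edges-not : ∀ X Y → edges X Y + edges X (not ∘ Y) ≡ 3 * count X
  edges-+-edges-not X Y = begin
    edges X Y + edges X (not ∘ Y)
      ≡⟨ cong₂ _+_ (edges≡ X Y) (edges≡ X (not ∘ Y)) ⟩
    sum (row Y) + sum (row (not ∘ Y))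
      ≡⟨ ∑-distrib-+ (row Y) (row (not ∘ Y)) ⟨
    sum (λ v → row Y v + row (not ∘ Y) v)
      ≡⟨ sum-cong-≗ (λ v → pointwise v (X v)) ⟩
    sum (λ v → 3 * toℕ (X v))
      ≡⟨ *-distribˡ-sum 3 (toℕ ∘ X) ⟨
    3 * count X ∎
    where
    open ≡-Reasoning
    row : (Fin n → Bool) → Fin n → ℕ
    row Z v = if X v then degreeIn Z v else 0
    pointwise : ∀ v x → (if x then degreeIn Y v else 0) + (if x then degreeIn (not ∘ Y) v else 0) ≡
                        3 * toℕ x
    pointwise v true  = degreeIn-+-degreeIn-not Y v
    pointwise v false = refl

  edges≤count : ∀ X Y → (∀ v → X v ≡ true → degreeIn Y v ≤ 1) → edges X Y ≤ count X
  edges≤count X Y few =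
    ≤-trans (≤-reflexive (edges≡ X Y)) (sum-mono-≤ (λ v → pointwise v (X v) refl))
    where
    pointwise : ∀ v x → X v ≡ x → (if x then degreeIn Y v else 0) ≤ toℕ x
    pointwise v true  Xv = few v Xv
    pointwise v false _  = z≤n

  1≤edges : ∀ {X Y u v} → X u ≡ true → Y v ≡ true → adj G u v ≡ true → 1 ≤ edges X Y
  1≤edges {X} {Y} {u} {v} Xu Yv uv =
    ≤-trans (1≤count (λ w → X u ∧ (Y w ∧ adj G u w)) (cong₂ _∧_ Xu (cong₂ _∧_ Yv uv)))
            (≤-sum (λ x → count (λ w → X x ∧ (Y w ∧ adj G x w))) u)

  heavy : (Fin n → Bool) → Fin n → Bool
  heavy I w = 2 ≤ᵇ degreeIn I w

  2≤ᵇ-true : ∀ {m} → 2 ≤ m → (2 ≤ᵇ m) ≡ true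
  2≤ᵇ-true (s≤s (s≤s _)) = refl

  2≤ᵇ-false : ∀ {m} → m ≤ 1 → (2 ≤ᵇ m) ≡ false
  2≤ᵇ-false z≤n       = refl
  2≤ᵇ-false (s≤s z≤n) = refl

  2≤ᵇ⇒2≤ : ∀ m → (2 ≤ᵇ m) ≡ true → 2 ≤ m
  2≤ᵇ⇒2≤ (suc (suc _)) _ = s≤s (s≤s z≤n)

  outside-of-isolated : ∀ {I v w} → degreeIn I v ≡ 0 → adj G v w ≡ true → I w ≡ false
  outside-of-isolated {I} {v} {w} dv≡0 vw with I w in Iw
  ... | false = refl
  ... | true  =
    ⊥-elim (n≮0 (subst (0 <_) dv≡0 (1≤count (λ x → I x ∧ adj G v x) (cong₂ _∧_ Iw vw))))

  isolated-has-heavy-neighbour : ∀ {I v} → Maximal I → I v ≡ false → degreeIn I v ≡ 0 →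
                                 1 ≤ degreeIn (heavy I) v
  isolated-has-heavy-neighbour {I} {v} maximal Iv dv≡0 with maximal v Iv
  ... | w , wv , 1<Cw =
    1≤count (λ x → heavy I x ∧ adj G v x) (cong₂ _∧_ (2≤ᵇ-true 2≤dw) vw)
    where
    Cv≡0 : closedDegreeIn I v ≡ 0
    Cv≡0 = trans (closedDegreeIn≡ I v) (cong₂ _+_ dv≡0 (cong toℕ Iv))
    w≢v : w ≢ v
    w≢v refl = n≮0 (subst (1 <_) Cv≡0 1<Cw)
    vw : adj G v w ≡ true
    vw = trans (symm G v w) (adj-if-inClosed wv w≢v)
    2≤dw : 2 ≤ degreeIn I w
    2≤dw = subst (2 ≤_) Cw≡dw 1<Cw
      where
      Cw≡dw : closedDegreeIn I w ≡ degreeIn I w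
      Cw≡dw = trans (closedDegreeIn≡ I w)
                    (trans (cong ((degreeIn I w +_) ∘ toℕ) (outside-of-isolated dv≡0 vw))
                           (+-identityʳ _))

  count-outside+count-heavy≤ : ∀ {I} → Sparse I → Maximal I →
    count (not ∘ I) + count (heavy I) ≤ edges (not ∘ I) I + edges (not ∘ I) (heavy I)
  count-outside+count-heavy≤ {I} sparse maximal = begin
    count (not ∘ I) + count (heavy I)
      ≡⟨ ∑-distrib-+ (toℕ ∘ not ∘ I) (toℕ ∘ heavy I) ⟨
    sum (λ v → toℕ (not (I v)) + toℕ (heavy I v))
      ≤⟨ sum-mono-≤ (λ v → pointwise v (I v) refl) ⟩
    sum (λ v → row I v + row (heavy I) v)
      ≡⟨ ∑-distrib-+ (row I) (row (heavy I)) ⟩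
    sum (row I) + sum (row (heavy I))
      ≡⟨ cong₂ _+_ (edges≡ (not ∘ I) I) (edges≡ (not ∘ I) (heavy I)) ⟨
    edges (not ∘ I) I + edges (not ∘ I) (heavy I) ∎
    where
    open ≤-Reasoning
    row : (Fin n → Bool) → Fin n → ℕ
    row Y v = if not (I v) then degreeIn Y v else 0
    outside : ∀ {v} → I v ≡ false →
              1 + toℕ (2 ≤ᵇ degreeIn I v) ≤ degreeIn I v + degreeIn (heavy I) v
    outside {v} Iv with degreeIn I v in dv
    ... | zero        = isolated-has-heavy-neighbour maximal Iv dv
    ... | suc zero    = s≤s z≤n
    ... | suc (suc _) = s≤s (s≤s z≤n)
    pointwise : ∀ v x → I v ≡ x → toℕ (not x) + toℕ (heavy I v) ≤
                (if not x then degreeIn I v else 0) + (if not x then degreeIn (heavy I) v else 0)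
    pointwise v true  Iv = ≤-reflexive (cong toℕ (2≤ᵇ-false (degreeIn≤1 sparse Iv)))
    pointwise v false Iv = outside Iv

  edges-heavy≤count-heavy : ∀ I → edges (heavy I) (not ∘ I) ≤ count (heavy I)
  edges-heavy≤count-heavy I = edges≤count (heavy I) (not ∘ I) few
    where
    few : ∀ w → heavy I w ≡ true → degreeIn (not ∘ I) w ≤ 1
    few w hw = +-cancelˡ-≤ 2 (degreeIn (not ∘ I) w) 1
      (≤-trans (+-monoˡ-≤ (degreeIn (not ∘ I) w) (2≤ᵇ⇒2≤ (degreeIn I w) hw))
               (≤-reflexive (degreeIn-+-degreeIn-not I w)))

  count-outside<3*count : ∀ {I a b} → Sparse I → Maximal I →
                          I a ≡ true → I b ≡ true → adj G a b ≡ true → count (not ∘ I) < 3 * count I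
  count-outside<3*count {I} sparse maximal Ia Ib ab = begin-strict
    count O                  ≤⟨ +-cancelʳ-≤ (count H) (count O) (edges I O) double-count ⟩
    edges I O                <⟨ m<m+n (edges I O) (1≤edges {I} {I} Ia Ib ab) ⟩
    edges I O + edges I I    ≡⟨ +-comm (edges I O) (edges I I) ⟩
    edges I I + edges I O    ≡⟨ edges-+-edges-not I I ⟩
    3 * count I              ∎
    where
    open ≤-Reasoning
    O H : Fin n → Bool
    O = not ∘ I
    H = heavy I
    double-count : count O + count H ≤ edges I O + count H
    double-count = begin
      count O + count H        ≤⟨ count-outside+count-heavy≤ sparse maximal ⟩
      edges O I + edges O H    ≡⟨ cong₂ _+_ (edges-comm O I) (edges-comm O H) ⟩
      edges I O + edges H O    ≤⟨ +-monoʳ-≤ (edges I O) (edges-heavy≤count-heavy I) ⟩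
      edges I O + count H      ∎

module SignedLabelling {n : ℕ} {G : Graph n} (cubic : Cubic G) where

  open FiniteCounts
  open IntegerArithmetic
  open Neighbourhoods G
  open CubicGraphs {G = G} cubic
  open import Data.Bool using (Bool; true; false; not; _∧_; if_then_else_)
  open import Data.Bool.Properties using (∧-conicalˡ; ∧-conicalʳ)
  open import Data.Empty using (⊥-elim)
  open import Data.Fin using (Fin)
  open import Data.Integer using (+_; _-_; _*_; _≤_; _<_)
  open import Data.Integer.Properties using (module ≤-Reasoning)
  import Data.Nat as ℕ
  import Data.Nat.Properties as ℕ
  open import Data.Product using (∃; ∃₂; _×_; _,_)
  open import Data.Sum using (inj₂)
  open import Function using (_∘_)
  open import Relation.Binary.PropositionalEquality using (_≡_; _≢_; refl; cong; trans; sym)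
  open import Algebra.Properties.Semiring.Sum ℕ.+-*-semiring using (*-distribˡ-sum)

  labelling : (Fin n → Bool) → Fin n → Label
  labelling I v = if I v then m1 else two

  val-labelling : ∀ x → val (if x then m1 else two) ≡ + (2 ℕ.* toℕ (not x)) - + toℕ x
  val-labelling true  = refl
  val-labelling false = refl

  restricted-val-labelling : ∀ c x → (if c then val (if x then m1 else two) else + 0) ≡
                                     + (2 ℕ.* toℕ (not x ∧ c)) - + toℕ (x ∧ c)
  restricted-val-labelling true  true  = refl
  restricted-val-labelling true  false = refl
  restricted-val-labelling false true  = refl
  restricted-val-labelling false false = refl

  weight-labelling : ∀ I → weight (labelling I) ≡ + (2 ℕ.* count (not ∘ I)) - + count I
  weight-labelling I =
    trans (sumℤ-allFin-difference _ (λ v → 2 ℕ.* toℕ (not (I v))) (toℕ ∘ I)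
                                    (val-labelling ∘ I))
          (cong (λ m → + m - + count I) (sym (*-distribˡ-sum 2 (toℕ ∘ not ∘ I))))

  closedSum-labelling : ∀ I u → closedSum G (labelling I) u ≡
                                + (2 ℕ.* closedDegreeIn (not ∘ I) u) - + closedDegreeIn I u
  closedSum-labelling I u =
    trans (sumℤ-allFin-difference _ (λ v → 2 ℕ.* toℕ (not (I v) ∧ inClosed G u v))
                                    (λ v → toℕ (I v ∧ inClosed G u v))
                                    (λ v → restricted-val-labelling (inClosed G u v) (I v)))
          (cong (λ m → + m - + closedDegreeIn I u)
                (sym (*-distribˡ-sum 2 (λ v → toℕ (not (I v) ∧ inClosed G u v)))))

  2+c≤2c′ : ∀ c c′ → c ℕ.+ c′ ≡ 4 → c ℕ.≤ 2 → 2 ℕ.+ c ℕ.≤ 2 ℕ.* c′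
  2+c≤2c′ 0 .4 refl _ = ℕ.s≤s (ℕ.s≤s ℕ.z≤n)
  2+c≤2c′ 1 .3 refl _ = ℕ.s≤s (ℕ.s≤s (ℕ.s≤s ℕ.z≤n))
  2+c≤2c′ 2 .2 refl _ = ℕ.≤-refl
  2+c≤2c′ (ℕ.suc (ℕ.suc (ℕ.suc _))) _ _ (ℕ.s≤s (ℕ.s≤s ()))

  labelling-isSDR2DF : ∀ {I} → Sparse I → IsSDRkDF G 2 (labelling I)
  labelling-isSDR2DF {I} sparse = record
    { cond1 = λ u lu → inj₂ (two-outside-neighbours (member-if-m1 (I u) lu))
    ; cond2 = λ u lu → ⊥-elim (≢one (I u) lu)
    ; cond3 = closedSum≥2
    }
    where
    member-if-m1 : ∀ x → (if x then m1 else two) ≡ m1 → x ≡ true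
    member-if-m1 true _ = refl
    ≢one : ∀ x → (if x then m1 else two) ≢ one
    ≢one true  ()
    ≢one false ()
    two-if-outside : ∀ x → not x ≡ true → (if x then m1 else two) ≡ two
    two-if-outside false _ = refl
    two-outside-neighbours : ∀ {u} → I u ≡ true →
      ∃₂ λ v w → v ≢ w × u ∼[ G ] v × u ∼[ G ] w
                 × labelling I v ≡ two × labelling I w ≡ two
    two-outside-neighbours {u} Iu =
      let v , w , v≢w , pv , pw = 1<count⇒∃₂ (λ x → not (I x) ∧ adj G u x) 1<d′
      in v , w , v≢w , ∧-conicalʳ _ _ pv , ∧-conicalʳ _ _ pw ,
         two-if-outside (I v) (∧-conicalˡ _ _ pv) , two-if-outside (I w) (∧-conicalˡ _ _ pw)
      where
      1<d′ : 1 ℕ.< degreeIn (not ∘ I) u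
      1<d′ = ℕ.+-cancelˡ-≤ 1 2 (degreeIn (not ∘ I) u)
               (ℕ.≤-trans (ℕ.≤-reflexive (sym (degreeIn-+-degreeIn-not I u)))
                          (ℕ.+-monoˡ-≤ (degreeIn (not ∘ I) u) (degreeIn≤1 sparse Iu)))
    closedSum≥2 : ∀ u → + 2 ≤ closedSum G (labelling I) u
    closedSum≥2 u = begin
      + 2
        ≤⟨ ≤-difference (2+c≤2c′ _ _ (closedDegreeIn-+-closedDegreeIn-not I u) (sparse u)) ⟩
      + (2 ℕ.* closedDegreeIn (not ∘ I) u) - + closedDegreeIn I u
        ≡⟨ closedSum-labelling I u ⟨
      closedSum G (labelling I) u ∎
      where open ≤-Reasoning

  4*weight-labelling< : ∀ {I a b} → Sparse I → Maximal I →
                        I a ≡ true → I b ≡ true → adj G a b ≡ true →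
                        + 4 * weight (labelling I) < + (5 ℕ.* n)
  4*weight-labelling< {I} sparse maximal Ia Ib ab = begin-strict
    + 4 * weight (labelling I)
      ≡⟨ cong (+ 4 *_) (weight-labelling I) ⟩
    + 4 * (+ (2 ℕ.* count (not ∘ I)) - + count I)
      <⟨ 4*[2o-i]<5*[i+o] (count I) (count (not ∘ I)) (count-outside<3*count sparse maximal Ia Ib ab) ⟩
    + (5 ℕ.* (count I ℕ.+ count (not ∘ I)))
      ≡⟨ cong (λ m → + (5 ℕ.* m)) (count-+-count-not I) ⟩
    + (5 ℕ.* n) ∎
    where open ≤-Reasoning

  light-SDR2DF : Fin n → ∃ λ f → IsSDRkDF G 2 f × + 4 * weight f < + (5 ℕ.* n)
  light-SDR2DF a =
    let b , ab = neighbour a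
        I , pair⊆I , sparse , maximal =
          maximal-sparse-superset (insert a (insert b ∅)) (sparse-pair a b)
    in labelling I , labelling-isSDR2DF sparse ,
       4*weight-labelling< sparse maximal (pair⊆I (insert-self a (insert b ∅)))
                                          (pair⊆I (⊆-insert a (insert b ∅) (insert-self b ∅))) ab

open SignedLabelling using (light-SDR2DF)
open import Data.Nat using (_≥_; s≤s; z≤n) renaming (_*_ to _*ℕ_; _≤_ to _≤ℕ_)
open import Data.Integer using (+_; _*_; _<_; +≤+)
open import Data.Integer.Properties using (≤-trans; ≤-<-trans; *-monoˡ-≤-nonNeg)
open import Data.Fin using (fromℕ<)
open import Data.Product using (_×_; _,_)

IsSDRkDF-antimono : ∀ {n} {G : Graph n} {j k f} → j ≤ℕ k → IsSDRkDF G k f → IsSDRkDF G j f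
IsSDRkDF-antimono j≤k isDF = record
  { cond1 = cond1 ; cond2 = cond2 ; cond3 = λ u → ≤-trans (+≤+ j≤k) (cond3 u) }
  where open IsSDRkDF isDF

4*weight<⇒4*γ< : ∀ {n} {G : Graph n} {k f γ} → IsSDRkDF G k f → IsSDRkDomNumber G k γ →
                 + 4 * weight f < + (5 *ℕ n) → + 4 * γ < + (5 *ℕ n)
4*weight<⇒4*γ< isDF (_ , minimal) light =
  ≤-<-trans (*-monoˡ-≤-nonNeg (+ 4) (minimal _ isDF)) light

proposition1 : ∀ {n : ℕ} (G : Graph n) → n ≥ 1 → Cubic G →
    (∀ γ → IsSDRkDomNumber G 2 γ → + 4 * γ < + (5 *ℕ n))
    × (∀ γ → IsSDRDomNumber G γ → + 4 * γ < + (5 *ℕ n))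
proposition1 G n≥1 cubic =
  let f , f-is-2DF , light = light-SDR2DF cubic (fromℕ< n≥1)
  in (λ γ minimum → 4*weight<⇒4*γ< f-is-2DF minimum light)
   , (λ γ minimum → 4*weight<⇒4*γ< (IsSDRkDF-antimono (s≤s z≤n) f-is-2DF) minimum light)
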